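{- Let $i,j\in[n]$ (possibly equal), let $\mathcal A,\mathcal B\subseteq\{a_1,\dots,a_m\}$ with $|\mathcal A|=|\mathcal B|=k$ and $|\mathcal A\cap\mathcal B|=M$ for some $1\le M\le k$, and let $S_1\in\mathcal G_{i,\mathcal A}$, $S_2\in\mathcal G_{j,\mathcal A}$, $T_1\in\mathcal G_{i,\mathcal B}$, $T_2\in\mathcal G_{j,\mathcal B}$. Suppose that (i) $S_1\ne S_2$ or $T_1\ne T_2$ or $V(S_1)\cap V(T_1)=\{i\}$, and (ii) every edge of $H=S_1\cup S_2\cup T_1\cup T_2$ belongs to at least two of $S_1,S_2,T_1,T_2$. Then for every attribute $a\in\mathcal A\cap\mathcal B$, exactly one of the following holds: (1) $a$ is incident to two edges of $H$, one belonging to (exactly) $S_1,S_2$ and the other to (exactly) $T_1,T_2$; (2) $a$ is incident to two edges of $H$, one belonging to $S_1,T_1$ and the other to $S_2,T_2$; (3) $a$ is incident to two edges of $H$, one belonging to $S_1,T_2$ and the other to $S_2,T_1$; (4) $a$ is incident to exactly one edge of $H$, which belongs to all four graphs $S_1,S_2,T_1,T_2$.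
   Context: Vertices are users $[n]$ and attributes $a_1,\dots,a_m$. For a user $r\in[n]$ and a set $\mathcal A$ of $k$ attributes, $\mathcal G_{r,\mathcal A}$ is the set of trees consisting of $k$ paths $r-u_t-\alpha_t$ ($t=1,\dots,k$), where $u_1,\dots,u_k$ are distinct users in $[n]\setminus\{r\}$ and $\{\alpha_1,\dots,\alpha_k\}=\mathcal A$. $V(S)$ denotes the vertex set of $S$. -}

module Defs where

open import Data.Nat using (ℕ)
open import Data.Fin using (Fin)
import Data.Fin as Fin
open import Data.Fin.Subset using (Subset; _∈_)
open import Data.Sum using (_⊎_; inj₁; inj₂)
open import Data.Product using (_×_; ∃; ∃-syntax)
open import Data.Empty using (⊥)
open import Relation.Nullary using (¬_)
open import Relation.Binary.PropositionalEquality using (_≡_; _≢_)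
open import Function.Bundles using (_⇔_)

Vertex : ℕ → ℕ → Set
Vertex n m = Fin n ⊎ Fin m

user : ∀ {n m} → Fin n → Vertex n m
user = inj₁

attr : ∀ {n m} → Fin m → Vertex n m
attr = inj₂

-- A tree in G_{r,A}: described by the assignment α ↦ u_α (only its values
-- on A matter), with u_α ≠ r and the u_α pairwise distinct for α ∈ A.
record Tree (n m : ℕ) (r : Fin n) (A : Subset m) : Set where
  field
    u     : Fin m → Fin n
    u≢r   : ∀ α → α ∈ A → u α ≢ r
    u-inj : ∀ α β → α ∈ A → β ∈ A → u α ≡ u β → α ≡ β
open Tree public

data DEdge {n m : ℕ} {r : Fin n} {A : Subset m} (S : Tree n m r A)
     : Vertex n m → Vertex n m → Set where
  top : ∀ α → α ∈ A → DEdge S (user r) (user (u S α))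
  bot : ∀ α → α ∈ A → DEdge S (user (u S α)) (attr α)

Edge : ∀ {n m r A} → Tree n m r A → Vertex n m → Vertex n m → Set
Edge S x y = DEdge S x y ⊎ DEdge S y x

Vert : ∀ {n m r A} → Tree n m r A → Vertex n m → Set
Vert {r = r} S v = (v ≡ user r) ⊎ ∃[ w ] Edge S v w

-- Equality of trees as graphs (same edge set; vertex set is determined).
SameGraph : ∀ {n m r r' A A'} → Tree n m r A → Tree n m r' A' → Set
SameGraph S T = ∀ x y → Edge S x y ⇔ Edge T x y

ExactlyOne4 : Set → Set → Set → Set → Set
ExactlyOne4 P₁ P₂ P₃ P₄ =
  (P₁ ⊎ P₂ ⊎ P₃ ⊎ P₄) ×
  (¬ (P₁ × P₂)) × (¬ (P₁ × P₃)) × (¬ (P₁ × P₄)) ×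
  (¬ (P₂ × P₃)) × (¬ (P₂ × P₄)) × (¬ (P₃ × P₄))

-- Membership of an edge in S₁,S₂,T₁,T₂ (indexed by Fin 4: 0=S₁,1=S₂,2=T₁,3=T₂).
-- Membership pattern: the edge lies in exactly the graphs marked true.
Pattern : Set → Set → Set → Set → (b₁ b₂ b₃ b₄ : Set → Set) → Set
Pattern e₁ e₂ e₃ e₄ b₁ b₂ b₃ b₄ = b₁ e₁ × b₂ e₂ × b₃ e₃ × b₄ e₄

yes' : Set → Set
yes' P = P

no' : Set → Set
no' P = ¬ P

In4 : Set → Set → Set → Set → Fin 4 → Set
In4 P Q R S Fin.zero = P
In4 P Q R S (Fin.suc Fin.zero) = Q
In4 P Q R S (Fin.suc (Fin.suc Fin.zero)) = R
In4 P Q R S (Fin.suc (Fin.suc (Fin.suc Fin.zero))) = S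

-- An attribute a ∈ A ∩ B has exactly one neighbour in each of the four trees,
-- namely the user u(a) of that tree; call these x₀, x₁, x₂, x₃ for S₁, S₂, T₁, T₂.
-- By (ii) the edge {x_s, a} lies in a second tree, i.e. every x_s equals some
-- other x_t.  Four points in which no point is alone are either all equal or
-- split into two pairs, and the three pairings together with the all-equal
-- case are exactly the four alternatives, which are mutually exclusive because
-- each one fixes whether x₀ = x₁, x₀ = x₂ and x₀ = x₃.
module Submission where

open import Defs
open import Data.Nat using (ℕ; _≤_)
open import Data.Fin using (Fin; _≟_)
open import Data.Fin.Patterns using (0F; 1F; 2F; 3F)
open import Data.Fin.Subset using (Subset; _∈_; _∩_; ∣_∣)
open import Data.Fin.Subset.Properties using (x∈p∩q⁻)
open import Data.Sum using (_⊎_; inj₁; inj₂)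
open import Data.Product using (_×_; ∃; ∃-syntax; _,_; proj₁; proj₂)
open import Data.Empty using (⊥-elim)
open import Relation.Nullary using (¬_; yes; no)
open import Relation.Binary.Definitions using (DecidableEquality)
open import Relation.Binary.PropositionalEquality using (_≡_; _≢_; refl; sym; trans; ≢-sym)

another-index : ∀ {ℓ ℓ′} {I : Set ℓ} {P : I → Set ℓ′} → DecidableEquality I →
                ∀ t {p q} → p ≢ q → P p → P q → ∃[ r ] (r ≢ t × P r)
another-index _≟ᵢ_ t {p} {q} p≢q Pp Pq with p ≟ᵢ t
... | yes refl = q , (λ q≡p → p≢q (sym q≡p)) , Pq
... | no  p≢t  = p , p≢t , Pp

In4⇒⊎ : ∀ {P Q R S : Set} t → In4 P Q R S t → P ⊎ Q ⊎ R ⊎ S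
In4⇒⊎ 0F p = inj₁ p
In4⇒⊎ 1F q = inj₂ (inj₁ q)
In4⇒⊎ 2F r = inj₂ (inj₂ (inj₁ r))
In4⇒⊎ 3F s = inj₂ (inj₂ (inj₂ s))

module _ {I A : Set} (x : I → A) where

  HasPartners : Set
  HasPartners = ∀ s → ∃[ t ] (t ≢ s × x s ≡ x t)

  -- If the indices are s, t, p, q and x s ≡ x t, then p and q can only be
  -- partnered with each other or with the common value of s and t.
  remaining-pair-equal : HasPartners → ∀ {s t p q} →
    (∀ r → r ≡ s ⊎ r ≡ t ⊎ r ≡ p ⊎ r ≡ q) → x s ≡ x t → x p ≡ x q
  remaining-pair-equal partner {s} {t} {p} {q} cover xₛ≡xₜ with joins p | joins q
    where
    joins : ∀ y → x y ≡ x s ⊎ ∃[ r ] (r ≢ y × (r ≡ p ⊎ r ≡ q) × x y ≡ x r)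
    joins y with partner y
    ... | r , r≢y , xy≡xr with cover r
    ...   | inj₁ refl        = inj₁ xy≡xr
    ...   | inj₂ (inj₁ refl) = inj₁ (trans xy≡xr (sym xₛ≡xₜ))
    ...   | inj₂ (inj₂ r∈pq) = inj₂ (r , r≢y , r∈pq , xy≡xr)
  ... | inj₂ (_ , r≢p , inj₁ refl , _)   | _                              = ⊥-elim (r≢p refl)
  ... | inj₂ (_ , _ , inj₂ refl , xp≡xq) | _                              = xp≡xq
  ... | inj₁ _                           | inj₂ (_ , r≢q , inj₂ refl , _) = ⊥-elim (r≢q refl)
  ... | inj₁ _                           | inj₂ (_ , _ , inj₁ refl , xq≡xp) = sym xq≡xp
  ... | inj₁ xp≡xs                       | inj₁ xq≡xs                     = trans xp≡xs (sym xq≡xs)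

module _ {A : Set} (x : Fin 4 → A) where

  data Pairing : Set where
    all-equal : x 0F ≡ x 1F → x 0F ≡ x 2F → x 0F ≡ x 3F → Pairing
    01∣23     : x 0F ≡ x 1F → x 2F ≡ x 3F → x 0F ≢ x 2F → Pairing
    02∣13     : x 0F ≡ x 2F → x 1F ≡ x 3F → x 0F ≢ x 1F → Pairing
    03∣12     : x 0F ≡ x 3F → x 1F ≡ x 2F → x 0F ≢ x 1F → Pairing

fin4≡0∣1∣2∣3 : ∀ (r : Fin 4) → r ≡ 0F ⊎ r ≡ 1F ⊎ r ≡ 2F ⊎ r ≡ 3F
fin4≡0∣1∣2∣3 0F = inj₁ refl
fin4≡0∣1∣2∣3 1F = inj₂ (inj₁ refl)
fin4≡0∣1∣2∣3 2F = inj₂ (inj₂ (inj₁ refl))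
fin4≡0∣1∣2∣3 3F = inj₂ (inj₂ (inj₂ refl))

fin4≡0∣2∣1∣3 : ∀ (r : Fin 4) → r ≡ 0F ⊎ r ≡ 2F ⊎ r ≡ 1F ⊎ r ≡ 3F
fin4≡0∣2∣1∣3 0F = inj₁ refl
fin4≡0∣2∣1∣3 1F = inj₂ (inj₂ (inj₁ refl))
fin4≡0∣2∣1∣3 2F = inj₂ (inj₁ refl)
fin4≡0∣2∣1∣3 3F = inj₂ (inj₂ (inj₂ refl))

fin4≡0∣3∣1∣2 : ∀ (r : Fin 4) → r ≡ 0F ⊎ r ≡ 3F ⊎ r ≡ 1F ⊎ r ≡ 2F
fin4≡0∣3∣1∣2 0F = inj₁ refl
fin4≡0∣3∣1∣2 1F = inj₂ (inj₂ (inj₁ refl))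
fin4≡0∣3∣1∣2 2F = inj₂ (inj₂ (inj₂ refl))
fin4≡0∣3∣1∣2 3F = inj₂ (inj₁ refl)

pairing : ∀ {A : Set} → DecidableEquality A → {x : Fin 4 → A} → HasPartners x → Pairing x
pairing _≟ₐ_ {x} partner with partner 0F
... | 0F , 0≢0 , _ = ⊥-elim (0≢0 refl)
... | 1F , _ , x₀≡x₁ with remaining-pair-equal x partner fin4≡0∣1∣2∣3 x₀≡x₁ | x 0F ≟ₐ x 2F
...   | x₂≡x₃ | yes x₀≡x₂ = all-equal x₀≡x₁ x₀≡x₂ (trans x₀≡x₂ x₂≡x₃)
...   | x₂≡x₃ | no  x₀≢x₂ = 01∣23 x₀≡x₁ x₂≡x₃ x₀≢x₂
pairing _≟ₐ_ {x} partner | 2F , _ , x₀≡x₂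
  with remaining-pair-equal x partner fin4≡0∣2∣1∣3 x₀≡x₂ | x 0F ≟ₐ x 1F
...   | x₁≡x₃ | yes x₀≡x₁ = all-equal x₀≡x₁ x₀≡x₂ (trans x₀≡x₁ x₁≡x₃)
...   | x₁≡x₃ | no  x₀≢x₁ = 02∣13 x₀≡x₂ x₁≡x₃ x₀≢x₁
pairing _≟ₐ_ {x} partner | 3F , _ , x₀≡x₃
  with remaining-pair-equal x partner fin4≡0∣3∣1∣2 x₀≡x₃ | x 0F ≟ₐ x 1F
...   | x₁≡x₂ | yes x₀≡x₁ = all-equal x₀≡x₁ (trans x₀≡x₁ x₁≡x₂) x₀≡x₃
...   | x₁≡x₂ | no  x₀≢x₁ = 03∣12 x₀≡x₃ x₁≡x₂ x₀≢x₁

-- In the application, E t w says that {w, a} is an edge of the t-th of S₁, S₂, T₁, T₂.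
module Neighbourhood {V : Set} (E : Fin 4 → V → Set) (x : Fin 4 → V)
         (E⇒≡x : ∀ t {w} → E t w → w ≡ x t) (E-x : ∀ t → E t (x t)) where

  ≡x⇒E : ∀ t {w} → w ≡ x t → E t w
  ≡x⇒E t refl = E-x t

  ≢x⇒¬E : ∀ t {w} → w ≢ x t → ¬ E t w
  ≢x⇒¬E t w≢xₜ e = w≢xₜ (E⇒≡x t e)

  InH : V → Set
  InH w = E 0F w ⊎ E 1F w ⊎ E 2F w ⊎ E 3F w

  InH⇒≡x : ∀ {w} → InH w → ∃[ t ] w ≡ x t
  InH⇒≡x (inj₁ e)               = 0F , E⇒≡x 0F e
  InH⇒≡x (inj₂ (inj₁ e))        = 1F , E⇒≡x 1F e
  InH⇒≡x (inj₂ (inj₂ (inj₁ e))) = 2F , E⇒≡x 2F e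
  InH⇒≡x (inj₂ (inj₂ (inj₂ e))) = 3F , E⇒≡x 3F e

  Pat : V → (b₀ b₁ b₂ b₃ : Set → Set) → Set
  Pat w = Pattern (E 0F w) (E 1F w) (E 2F w) (E 3F w)

  Two : (P Q : V → Set) → Set
  Two P Q = ∃[ w₁ ] ∃[ w₂ ] (w₁ ≢ w₂ × P w₁ × Q w₂ × (∀ w → InH w → (w ≡ w₁) ⊎ (w ≡ w₂)))

  Split01∣23 Split02∣13 Split03∣12 Shared : Set
  Split01∣23 = Two (λ w → Pat w yes' yes' no' no') (λ w → Pat w no' no' yes' yes')
  Split02∣13 = Two (λ w → Pat w yes' no' yes' no') (λ w → Pat w no' yes' no' yes')
  Split03∣12 = Two (λ w → Pat w yes' no' no' yes') (λ w → Pat w no' yes' yes' no')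
  Shared     = ∃[ w ] (Pat w yes' yes' yes' yes' × (∀ w' → InH w' → w' ≡ w))

  InH-between : ∀ {w₁ w₂} → (∀ t → x t ≡ w₁ ⊎ x t ≡ w₂) → ∀ w → InH w → w ≡ w₁ ⊎ w ≡ w₂
  InH-between x-between w inH with InH⇒≡x inH
  ... | t , w≡xₜ with x-between t
  ...   | inj₁ xₜ≡w₁ = inj₁ (trans w≡xₜ xₜ≡w₁)
  ...   | inj₂ xₜ≡w₂ = inj₂ (trans w≡xₜ xₜ≡w₂)

  E⇒x≡x : ∀ s t {w} → E s w → E t w → x s ≡ x t
  E⇒x≡x s t eₛ eₜ = trans (sym (E⇒≡x s eₛ)) (E⇒≡x t eₜ)

  E⇒x≢x : ∀ s t {w} → E s w → ¬ E t w → x s ≢ x t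
  E⇒x≢x s t eₛ ¬eₜ xₛ≡xₜ = ¬eₜ (≡x⇒E t (trans (E⇒≡x s eₛ) xₛ≡xₜ))

  E-at : ∀ t {w} → x t ≡ w → E t w
  E-at t xₜ≡w = ≡x⇒E t (sym xₜ≡w)

  ¬E-at : ∀ t {w w'} → w ≢ w' → x t ≡ w' → ¬ E t w
  ¬E-at t w≢w' xₜ≡w' = ≢x⇒¬E t (λ w≡xₜ → w≢w' (trans w≡xₜ xₜ≡w'))

  pairing⇒case : Pairing x → Split01∣23 ⊎ Split02∣13 ⊎ Split03∣12 ⊎ Shared
  pairing⇒case (all-equal x₀≡x₁ x₀≡x₂ x₀≡x₃) =
    inj₂ (inj₂ (inj₂ (x 0F , (E-x 0F , E-at 1F (sym x₀≡x₁) , E-at 2F (sym x₀≡x₂) , E-at 3F (sym x₀≡x₃)) ,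
      λ w inH → let (t , w≡xₜ) = InH⇒≡x inH in trans w≡xₜ (x≡x₀ t))))
    where
    x≡x₀ : ∀ t → x t ≡ x 0F
    x≡x₀ 0F = refl
    x≡x₀ 1F = sym x₀≡x₁
    x≡x₀ 2F = sym x₀≡x₂
    x≡x₀ 3F = sym x₀≡x₃
  pairing⇒case (01∣23 x₀≡x₁ x₂≡x₃ x₀≢x₂) =
    inj₁ (x 0F , x 2F , x₀≢x₂ ,
      (E-x 0F , E-at 1F (sym x₀≡x₁) , ¬E-at 2F x₀≢x₂ refl , ¬E-at 3F x₀≢x₂ (sym x₂≡x₃)) ,
      (¬E-at 0F x₂≢x₀ refl , ¬E-at 1F x₂≢x₀ (sym x₀≡x₁) , E-x 2F , E-at 3F (sym x₂≡x₃)) ,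
      InH-between side)
    where
    x₂≢x₀ : x 2F ≢ x 0F
    x₂≢x₀ = ≢-sym x₀≢x₂
    side : ∀ t → x t ≡ x 0F ⊎ x t ≡ x 2F
    side 0F = inj₁ refl
    side 1F = inj₁ (sym x₀≡x₁)
    side 2F = inj₂ refl
    side 3F = inj₂ (sym x₂≡x₃)
  pairing⇒case (02∣13 x₀≡x₂ x₁≡x₃ x₀≢x₁) =
    inj₂ (inj₁ (x 0F , x 1F , x₀≢x₁ ,
      (E-x 0F , ¬E-at 1F x₀≢x₁ refl , E-at 2F (sym x₀≡x₂) , ¬E-at 3F x₀≢x₁ (sym x₁≡x₃)) ,
      (¬E-at 0F x₁≢x₀ refl , E-x 1F , ¬E-at 2F x₁≢x₀ (sym x₀≡x₂) , E-at 3F (sym x₁≡x₃)) ,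
      InH-between side))
    where
    x₁≢x₀ : x 1F ≢ x 0F
    x₁≢x₀ = ≢-sym x₀≢x₁
    side : ∀ t → x t ≡ x 0F ⊎ x t ≡ x 1F
    side 0F = inj₁ refl
    side 1F = inj₂ refl
    side 2F = inj₁ (sym x₀≡x₂)
    side 3F = inj₂ (sym x₁≡x₃)
  pairing⇒case (03∣12 x₀≡x₃ x₁≡x₂ x₀≢x₁) =
    inj₂ (inj₂ (inj₁ (x 0F , x 1F , x₀≢x₁ ,
      (E-x 0F , ¬E-at 1F x₀≢x₁ refl , ¬E-at 2F x₀≢x₁ (sym x₁≡x₂) , E-at 3F (sym x₀≡x₃)) ,
      (¬E-at 0F x₁≢x₀ refl , E-x 1F , E-at 2F (sym x₁≡x₂) , ¬E-at 3F x₁≢x₀ (sym x₀≡x₃)) ,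
      InH-between side)))
    where
    x₁≢x₀ : x 1F ≢ x 0F
    x₁≢x₀ = ≢-sym x₀≢x₁
    side : ∀ t → x t ≡ x 0F ⊎ x t ≡ x 1F
    side 0F = inj₁ refl
    side 1F = inj₂ refl
    side 2F = inj₂ (sym x₁≡x₂)
    side 3F = inj₁ (sym x₀≡x₃)

  Split01∣23⇒ : Split01∣23 → x 0F ≡ x 1F × x 0F ≢ x 2F
  Split01∣23⇒ (_ , _ , _ , (e₀ , e₁ , ¬e₂ , _) , _) = E⇒x≡x 0F 1F e₀ e₁ , E⇒x≢x 0F 2F e₀ ¬e₂

  Split02∣13⇒ : Split02∣13 → x 0F ≢ x 1F × x 0F ≢ x 3F
  Split02∣13⇒ (_ , _ , _ , (e₀ , ¬e₁ , _ , ¬e₃) , _) = E⇒x≢x 0F 1F e₀ ¬e₁ , E⇒x≢x 0F 3F e₀ ¬e₃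

  Split03∣12⇒ : Split03∣12 → x 0F ≢ x 1F × x 0F ≡ x 3F
  Split03∣12⇒ (_ , _ , _ , (e₀ , ¬e₁ , _ , e₃) , _) = E⇒x≢x 0F 1F e₀ ¬e₁ , E⇒x≡x 0F 3F e₀ e₃

  Shared⇒ : Shared → x 0F ≡ x 1F × x 0F ≡ x 2F
  Shared⇒ (_ , (e₀ , e₁ , e₂ , _) , _) = E⇒x≡x 0F 1F e₀ e₁ , E⇒x≡x 0F 2F e₀ e₂

  exactly-one : Pairing x → ExactlyOne4 Split01∣23 Split02∣13 Split03∣12 Shared
  exactly-one p = pairing⇒case p
    , (λ (c₁ , c₂) → proj₁ (Split02∣13⇒ c₂) (proj₁ (Split01∣23⇒ c₁)))
    , (λ (c₁ , c₃) → proj₁ (Split03∣12⇒ c₃) (proj₁ (Split01∣23⇒ c₁)))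
    , (λ (c₁ , c₄) → proj₂ (Split01∣23⇒ c₁) (proj₂ (Shared⇒ c₄)))
    , (λ (c₂ , c₃) → proj₂ (Split02∣13⇒ c₂) (proj₂ (Split03∣12⇒ c₃)))
    , (λ (c₂ , c₄) → proj₁ (Split02∣13⇒ c₂) (proj₁ (Shared⇒ c₄)))
    , (λ (c₃ , c₄) → proj₁ (Split03∣12⇒ c₃) (proj₁ (Shared⇒ c₄)))

attr-edge⇒≡u : ∀ {n m r A} (S : Tree n m r A) {a w} → Edge S (user w) (attr a) → w ≡ u S a
attr-edge⇒≡u S (inj₁ (bot _ _)) = refl
attr-edge⇒≡u S (inj₂ ())

u-attr-edge : ∀ {n m r A} (S : Tree n m r A) {a} → a ∈ A → Edge S (user (u S a)) (attr a)
u-attr-edge S a∈A = inj₁ (bot _ a∈A)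

EveryEdgeTwice : ∀ {n m i j A B} →
  Tree n m i A → Tree n m j A → Tree n m i B → Tree n m j B → Set
EveryEdgeTwice S₁ S₂ T₁ T₂ = ∀ x y →
  let inₜ = In4 (Edge S₁ x y) (Edge S₂ x y) (Edge T₁ x y) (Edge T₂ x y) in
  (Edge S₁ x y ⊎ Edge S₂ x y ⊎ Edge T₁ x y ⊎ Edge T₂ x y) →
  ∃[ p ] ∃[ q ] (p ≢ q × inₜ p × inₜ q)

module AttributeNeighbours {n m i j A B}
  (S₁ : Tree n m i A) (S₂ : Tree n m j A) (T₁ : Tree n m i B) (T₂ : Tree n m j B)
  {a : Fin m} (a∈A : a ∈ A) (a∈B : a ∈ B) where

  E : Fin 4 → Fin n → Set
  E t w = In4 (Edge S₁ (user w) (attr a)) (Edge S₂ (user w) (attr a))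
              (Edge T₁ (user w) (attr a)) (Edge T₂ (user w) (attr a)) t

  x : Fin 4 → Fin n
  x 0F = u S₁ a
  x 1F = u S₂ a
  x 2F = u T₁ a
  x 3F = u T₂ a

  E⇒≡x : ∀ t {w} → E t w → w ≡ x t
  E⇒≡x 0F = attr-edge⇒≡u S₁
  E⇒≡x 1F = attr-edge⇒≡u S₂
  E⇒≡x 2F = attr-edge⇒≡u T₁
  E⇒≡x 3F = attr-edge⇒≡u T₂

  E-x : ∀ t → E t (x t)
  E-x 0F = u-attr-edge S₁ a∈A
  E-x 1F = u-attr-edge S₂ a∈A
  E-x 2F = u-attr-edge T₁ a∈B
  E-x 3F = u-attr-edge T₂ a∈B

  has-partners : EveryEdgeTwice S₁ S₂ T₁ T₂ → HasPartners x
  has-partners twice s with twice (user (x s)) (attr a) (In4⇒⊎ s (E-x s))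
  ... | p , q , p≢q , inₚ , in-q with another-index {P = λ r → E r (x s)} _≟_ s p≢q inₚ in-q
  ...   | r , r≢s , Eᵣ = r , r≢s , E⇒≡x r Eᵣ

  open Neighbourhood E x E⇒≡x E-x public

lemma3 : ∀ {n m k M : ℕ} (i j : Fin n) (A B : Subset m) →
  ∣ A ∣ ≡ k → ∣ B ∣ ≡ k → ∣ A ∩ B ∣ ≡ M → 1 ≤ M → M ≤ k →
  (S₁ : Tree n m i A) (S₂ : Tree n m j A) (T₁ : Tree n m i B) (T₂ : Tree n m j B) →
  ((¬ SameGraph S₁ S₂) ⊎ (¬ SameGraph T₁ T₂) ⊎
    (∀ v → Vert S₁ v → Vert T₁ v → v ≡ user i)) →
  (∀ x y → (Edge S₁ x y ⊎ Edge S₂ x y ⊎ Edge T₁ x y ⊎ Edge T₂ x y) →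
    ∃[ p ] ∃[ q ] (p ≢ q ×
      In4 (Edge S₁ x y) (Edge S₂ x y) (Edge T₁ x y) (Edge T₂ x y) p ×
      In4 (Edge S₁ x y) (Edge S₂ x y) (Edge T₁ x y) (Edge T₂ x y) q)) →
  ∀ a → a ∈ A ∩ B →
  let e₁ = λ w → Edge S₁ (user w) (attr a)
      e₂ = λ w → Edge S₂ (user w) (attr a)
      e₃ = λ w → Edge T₁ (user w) (attr a)
      e₄ = λ w → Edge T₂ (user w) (attr a)
      inH = λ w → e₁ w ⊎ e₂ w ⊎ e₃ w ⊎ e₄ w
      pat = λ w b₁ b₂ b₃ b₄ → Pattern (e₁ w) (e₂ w) (e₃ w) (e₄ w) b₁ b₂ b₃ b₄
      two = λ (P Q : Fin n → Set) → ∃[ w₁ ] ∃[ w₂ ] (w₁ ≢ w₂ × P w₁ × Q w₂ ×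
              (∀ w → inH w → (w ≡ w₁) ⊎ (w ≡ w₂)))
  in ExactlyOne4
    (two (λ w → pat w yes' yes' no' no') (λ w → pat w no' no' yes' yes'))
    (two (λ w → pat w yes' no' yes' no') (λ w → pat w no' yes' no' yes'))
    (two (λ w → pat w yes' no' no' yes') (λ w → pat w no' yes' yes' no'))
    (∃[ w ] (pat w yes' yes' yes' yes' × (∀ w' → inH w' → w' ≡ w)))
lemma3 i j A B _ _ _ _ _ S₁ S₂ T₁ T₂ _ twice a a∈A∩B =
  exactly-one (pairing _≟_ (has-partners twice))
  where
  open AttributeNeighbours S₁ S₂ T₁ T₂ (proj₁ (x∈p∩q⁻ A B a∈A∩B)) (proj₂ (x∈p∩q⁻ A B a∈A∩B))
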